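{- Let $G = Z_{15}\times Z_{77}$ with multiplication $[x,y][u,v] = [x+u \bmod 15,\; y\cdot 4^{u} + v \bmod 77]$ (a group of order $1155$, the semidirect product $15\times_4 77$). Let $S=\{g,g^{ -1} : g\in\{[6,2],[10,9]\}\}$. Then $S$ consists of exactly $4$ non-identity elements and the Cayley graph $\mathrm{Cay}(G,S)$ is a connected $4$-regular graph of diameter $7$ on $1155$ vertices.
   Context: For a finite group $G$ and an inverse-closed subset $S\subseteq G$ not containing the identity, the Cayley graph $\mathrm{Cay}(G,S)$ is the undirected graph with vertex set $G$ in which $x$ and $y$ are adjacent iff $y=xs$ for some $s\in S$; it is $|S|$-regular. The diameter of a connected graph is the maximum over all pairs of vertices of the length of a shortest path between them. For integers $m,n$ and a unit $a$ of $Z_n$ whose multiplicative order divides $m$, the group $m\times_a n$ is the set $Z_m\times Z_n$ with multiplication $[x,y][u,v]=[x+u \bmod m,\; y a^u+v \bmod n]$. -}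

module Defs where

open import Data.Nat using (ℕ; zero; suc; _+_; _*_; _^_; _≤_; _%_) renaming (_∸_ to _-_)
open import Data.Nat.DivMod using (m%n<n)
open import Data.Fin using (Fin; toℕ; fromℕ<)
open import Data.Fin.Properties using () renaming (_≟_ to _≟ᶠ_)
open import Data.Product using (_×_; _,_; ∃-syntax)
open import Data.Product.Properties using (≡-dec)
open import Data.List using (List; []; _∷_; length; filter; allFin; cartesianProduct)
open import Data.List.Relation.Unary.Any using (Any; any?)
open import Relation.Binary.PropositionalEquality using (_≡_)
open import Relation.Binary.Definitions using (DecidableEquality)
open import Relation.Nullary using (Dec)

mod : (k : ℕ) → ℕ → Fin (suc k)
mod k m = fromℕ< (m%n<n m (suc k))

G : Set
G = Fin 15 × Fin 77

_≟G_ : DecidableEquality G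
_≟G_ = ≡-dec _≟ᶠ_ _≟ᶠ_

_·_ : G → G → G
(x , y) · (u , v) = mod 14 (toℕ x + toℕ u) , mod 76 (toℕ y * 4 ^ toℕ u + toℕ v)

e : G
e = mod 14 0 , mod 76 0

-- inverse: [x,y]⁻¹ = [-x mod 15, -(y·4^(-x)) mod 77]
inv : G → G
inv (x , y) = mod 14 (15 + 15 * 15 - toℕ x)
            , mod 76 ((77 - 1) * (toℕ y * 4 ^ toℕ (mod 14 (15 + 15 * 15 - toℕ x))))



allG : List G
allG = cartesianProduct (allFin 15) (allFin 77)

g₁ g₂ : G
g₁ = mod 14 6 , mod 76 2
g₂ = mod 14 10 , mod 76 9

S : List G
S = g₁ ∷ inv g₁ ∷ g₂ ∷ inv g₂ ∷ []

Adj : G → G → Set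
Adj x y = Any (λ s → y ≡ x · s) S

Adj? : (x y : G) → Dec (Adj x y)
Adj? x y = any? (λ s → y ≟G (x · s)) S

neighbours : G → List G
neighbours x = filter (Adj? x) allG

data Walk : G → G → ℕ → Set where
  here  : ∀ {x} → Walk x x 0
  step  : ∀ {x y z n} → Adj x y → Walk y z n → Walk x z (suc n)

DistLE : G → G → ℕ → Set
DistLE x y k = ∃[ n ] (n ≤ k × Walk x y n)

Connected : Set
Connected = ∀ x y → ∃[ n ] Walk x y n

HasDiameter : ℕ → Set
HasDiameter d = (∀ x y → DistLE x y d)
              × ∃[ x ] ∃[ y ] (DistLE x y d × (∀ n → Walk x y n → d ≤ n))

Regular : ℕ → Set
Regular k = ∀ x → length (neighbours x) ≡ k

-- G is the semidirect product Z₁₅ ⋉ Z₇₇ in which Z₁₅ acts by powers of 4; its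
-- multiplication is associative because 4 ^ 15 ≡ 1 (mod 77). The other group laws and all
-- remaining finite facts are decided by running through the 1155 elements. Left translation
-- is an automorphism of Cay(G,S), so it suffices to measure distances from e. A table d of
-- these distances is certified in both directions: every h ≠ e has a neighbour g with
-- d g + 1 = d h, giving walks from e of length d h ≤ 7; and d grows by at most one along an
-- edge, so every walk from e to [12,21], where d = 7, has length at least 7.

module Submission where

open import Defs
open import Data.Nat using (ℕ; zero; suc; _+_; _*_; _^_; _%_; _/_; _≤_; _≤?_; NonZero)
open import Data.Nat.Properties
  using (_≟_; +-assoc; +-suc; +-identityʳ; *-comm; *-identityʳ; ^-distribˡ-+-*; ^-*-assoc; ^-zeroˡ;
         suc-injective; 0≢1+n; 1+n≢0; ≤-reflexive; +-monoˡ-≤; module ≤-Reasoning)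
open import Data.Nat.DivMod using (%-distribˡ-+; %-distribˡ-*; m%n%n≡m%n; m≡m%n+[m/n]*n)
open import Data.Nat.Tactic.RingSolver using (solve-∀)
open import Data.Fin using (Fin; toℕ)
open import Data.Fin.Properties using (toℕ-fromℕ<; toℕ-injective)
open import Data.Product using (_×_; _,_; proj₂; ∃-syntax)
open import Data.Sum using (_⊎_; inj₁; inj₂; map₂)
open import Data.Vec using (Vec; []; _∷_; lookup)
open import Data.List using (length; map; filter)
open import Data.List.Properties using (length-map)
open import Data.List.Relation.Unary.All as All using (All; all?)
open import Data.List.Relation.Unary.Any as Any using (Any; any?)
open import Data.List.Relation.Unary.Any.Properties using (map⁺; map⁻)
open import Data.List.Relation.Unary.Unique.Propositional using (Unique)
open import Data.List.Relation.Unary.Unique.Propositional.Properties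
  using (cartesianProduct⁺; allFin⁺; filter⁺) renaming (map⁺ to unique-map⁺)
open import Data.List.Relation.Unary.Unique.DecPropositional _≟G_ using (unique?)
open import Data.List.Membership.Propositional using (_∈_)
open import Data.List.Membership.Propositional.Properties using (∈-cartesianProduct⁺; ∈-allFin; ∈-filter⁺; ∈-filter⁻)
open import Data.List.Membership.Propositional.Properties.WithK using (unique∧set⇒bag)
open import Data.List.Relation.Binary.BagAndSetEquality using (∼bag⇒↭)
open import Data.List.Relation.Binary.Permutation.Propositional using (_↭_)
open import Data.List.Relation.Binary.Permutation.Propositional.Properties using (↭-length)
open import Function.Bundles using (mk⇔)
open import Relation.Binary.Bundles using (Setoid)
import Relation.Binary.Reasoning.Setoid as SetoidReasoning
open import Relation.Binary.PropositionalEquality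
open import Relation.Nullary using (¬?; contradiction; _×-dec_; _⊎-dec_)
open import Relation.Nullary.Decidable using (True; toWitness)
open import Relation.Unary using (Decidable)

module Modulo (d : ℕ) .{{_ : NonZero d}} where

  -- A record rather than a function, so that unification can read m and n off m ≈ n.
  infix 4 _≈_
  record _≈_ (m n : ℕ) : Set where
    constructor mod≡
    field %≡% : m % d ≡ n % d
  open _≈_ public

  ≈-setoid : Setoid _ _
  ≈-setoid = record
    { _≈_ = _≈_
    ; isEquivalence = record
      { refl  = mod≡ refl
      ; sym   = λ m≈n → mod≡ (sym (%≡% m≈n))
      ; trans = λ m≈n n≈o → mod≡ (trans (%≡% m≈n) (%≡% n≈o))
      }
    }

  open Setoid ≈-setoid public using () renaming (refl to ≈-refl)

  %-≈ : ∀ m → m % d ≈ m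
  %-≈ m = mod≡ (m%n%n≡m%n m d)

  +-cong : ∀ {m m′ n n′} → m ≈ m′ → n ≈ n′ → m + n ≈ m′ + n′
  +-cong {m} {m′} {n} {n′} (mod≡ m≈m′) (mod≡ n≈n′) = mod≡ (begin
    (m + n) % d            ≡⟨ %-distribˡ-+ m n d ⟩
    (m % d + n % d) % d    ≡⟨ cong₂ (λ a b → (a + b) % d) m≈m′ n≈n′ ⟩
    (m′ % d + n′ % d) % d  ≡⟨ %-distribˡ-+ m′ n′ d ⟨
    (m′ + n′) % d          ∎)
    where open ≡-Reasoning

  *-cong : ∀ {m m′ n n′} → m ≈ m′ → n ≈ n′ → m * n ≈ m′ * n′
  *-cong {m} {m′} {n} {n′} (mod≡ m≈m′) (mod≡ n≈n′) = mod≡ (begin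
    (m * n) % d              ≡⟨ %-distribˡ-* m n d ⟩
    (m % d * (n % d)) % d    ≡⟨ cong₂ (λ a b → (a * b) % d) m≈m′ n≈n′ ⟩
    (m′ % d * (n′ % d)) % d  ≡⟨ %-distribˡ-* m′ n′ d ⟨
    (m′ * n′) % d            ∎)
    where open ≡-Reasoning

  ^-congˡ : ∀ {m m′} k → m ≈ m′ → m ^ k ≈ m′ ^ k
  ^-congˡ zero    m≈m′ = ≈-refl
  ^-congˡ (suc k) m≈m′ = *-cong m≈m′ (^-congˡ k m≈m′)

  ^-periodic : ∀ a p .{{_ : NonZero p}} → a ^ p ≈ 1 → ∀ t → a ^ (t % p) ≈ a ^ t
  ^-periodic a p a^p≈1 t = begin
    a ^ (t % p)                         ≡⟨ *-identityʳ _ ⟨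
    a ^ (t % p) * 1                     ≡⟨ cong (a ^ (t % p) *_) (^-zeroˡ (t / p)) ⟨
    a ^ (t % p) * 1 ^ (t / p)           ≈⟨ *-cong (≈-refl {a ^ (t % p)}) (^-congˡ (t / p) a^p≈1) ⟨
    a ^ (t % p) * (a ^ p) ^ (t / p)     ≡⟨ cong (a ^ (t % p) *_) (^-*-assoc a p (t / p)) ⟩
    a ^ (t % p) * a ^ (p * (t / p))     ≡⟨ ^-distribˡ-+-* a (t % p) (p * (t / p)) ⟨
    a ^ (t % p + p * (t / p))           ≡⟨ cong (λ q → a ^ (t % p + q)) (*-comm p (t / p)) ⟩
    a ^ (t % p + t / p * p)             ≡⟨ cong (a ^_) (m≡m%n+[m/n]*n t p) ⟨
    a ^ t                               ∎
    where open SetoidReasoning ≈-setoid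

toℕ-mod : ∀ k t → toℕ (mod k t) ≡ t % suc k
toℕ-mod k t = toℕ-fromℕ< _

module _ (k : ℕ) where
  open Modulo (suc k)

  toℕ-mod-≈ : ∀ t → toℕ (mod k t) ≈ t
  toℕ-mod-≈ t = mod≡ (trans (cong (_% suc k) (toℕ-mod k t)) (%≡% (%-≈ t)))

  mod-cong : ∀ {t t′} → t ≈ t′ → mod k t ≡ mod k t′
  mod-cong {t} {t′} t≈t′ = toℕ-injective (begin
    toℕ (mod k t)   ≡⟨ toℕ-mod k t ⟩
    t % suc k       ≡⟨ %≡% t≈t′ ⟩
    t′ % suc k      ≡⟨ toℕ-mod k t′ ⟨
    toℕ (mod k t′)  ∎)
    where open ≡-Reasoning

affine-compose : ∀ y v q b c → (y * b + v) * c + q ≡ y * (b * c) + (v * c + q)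
affine-compose = solve-∀

module SemidirectProduct (k l a : ℕ) where

  infixl 7 _⋆_
  _⋆_ : Fin (suc k) × Fin (suc l) → Fin (suc k) × Fin (suc l) → Fin (suc k) × Fin (suc l)
  (x , y) ⋆ (u , v) = mod k (toℕ x + toℕ u) , mod l (toℕ y * a ^ toℕ u + toℕ v)

  ⋆-assoc : Modulo._≈_ (suc l) (a ^ suc k) 1 → ∀ g h f → (g ⋆ h) ⋆ f ≡ g ⋆ (h ⋆ f)
  ⋆-assoc a^m≈1 (x , y) (u , v) (p , q) = cong₂ _,_ (mod-cong k component₁) (mod-cong l component₂)
    where
    X = toℕ x ; Y = toℕ y ; U = toℕ u ; V = toℕ v ; P = toℕ p ; Q = toℕ q

    component₁ : Modulo._≈_ (suc k) (toℕ (mod k (X + U)) + P) (X + toℕ (mod k (U + P)))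
    component₁ = begin
      toℕ (mod k (X + U)) + P  ≈⟨ +-cong (toℕ-mod-≈ k (X + U)) ≈-refl ⟩
      X + U + P                ≡⟨ +-assoc X U P ⟩
      X + (U + P)              ≈⟨ +-cong ≈-refl (toℕ-mod-≈ k (U + P)) ⟨
      X + toℕ (mod k (U + P))  ∎
      where open Modulo (suc k)
            open SetoidReasoning ≈-setoid

    R = V * a ^ P + Q

    component₂ : Modulo._≈_ (suc l) (toℕ (mod l (Y * a ^ U + V)) * a ^ P + Q)
                                    (Y * a ^ toℕ (mod k (U + P)) + toℕ (mod l R))
    component₂ = begin
      toℕ (mod l (Y * a ^ U + V)) * a ^ P + Q
        ≈⟨ +-cong (*-cong (toℕ-mod-≈ l (Y * a ^ U + V)) (≈-refl {a ^ P})) (≈-refl {Q}) ⟩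
      (Y * a ^ U + V) * a ^ P + Q
        ≡⟨ affine-compose Y V Q (a ^ U) (a ^ P) ⟩
      Y * (a ^ U * a ^ P) + R
        ≡⟨ cong (λ b → Y * b + R) (^-distribˡ-+-* a U P) ⟨
      Y * a ^ (U + P) + R
        ≈⟨ +-cong (*-cong (≈-refl {Y}) (^-periodic a (suc k) a^m≈1 (U + P))) (toℕ-mod-≈ l R) ⟨
      Y * a ^ ((U + P) % suc k) + toℕ (mod l R)
        ≡⟨ cong (λ t → Y * a ^ t + toℕ (mod l R)) (toℕ-mod k (U + P)) ⟨
      Y * a ^ toℕ (mod k (U + P)) + toℕ (mod l R)
        ∎
      where open Modulo (suc l)
            open SetoidReasoning ≈-setoid

-- _·_ is definitionally _⋆_ at k = 14, l = 76, a = 4.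
open SemidirectProduct 14 76 4 using (⋆-assoc)

·-assoc : ∀ g h f → (g · h) · f ≡ g · (h · f)
·-assoc = ⋆-assoc (Modulo.mod≡ refl)

∈-allG : ∀ g → g ∈ allG
∈-allG (x , y) = ∈-cartesianProduct⁺ (∈-allFin x) (∈-allFin y)

allG-unique : Unique allG
allG-unique = cartesianProduct⁺ (allFin⁺ 15) (allFin⁺ 77)

by-exhaustion : {P : G → Set} (P? : Decidable P) → True (all? P? allG) → ∀ g → P g
by-exhaustion P? all-P g = All.lookup (toWitness all-P) (∈-allG g)

·-identityˡ : ∀ g → e · g ≡ g
·-identityˡ = by-exhaustion (λ g → (e · g) ≟G g) _

·-identityʳ : ∀ g → g · e ≡ g
·-identityʳ = by-exhaustion (λ g → (g · e) ≟G g) _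

·-inverseˡ : ∀ g → inv g · g ≡ e
·-inverseˡ = by-exhaustion (λ g → (inv g · g) ≟G e) _

·-inverseʳ : ∀ g → g · inv g ≡ e
·-inverseʳ = by-exhaustion (λ g → (g · inv g) ≟G e) _

·-cancelˡ : ∀ g {h f} → g · h ≡ g · f → h ≡ f
·-cancelˡ g {h} {f} gh≡gf = begin
  h                ≡⟨ ·-identityˡ h ⟨
  e · h            ≡⟨ cong (_· h) (·-inverseˡ g) ⟨
  (inv g · g) · h  ≡⟨ ·-assoc (inv g) g h ⟩
  inv g · (g · h)  ≡⟨ cong (inv g ·_) gh≡gf ⟩
  inv g · (g · f)  ≡⟨ ·-assoc (inv g) g f ⟨
  (inv g · g) · f  ≡⟨ cong (_· f) (·-inverseˡ g) ⟩
  e · f            ≡⟨ ·-identityˡ f ⟩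
  f                ∎
  where open ≡-Reasoning

·-inverseʳ-cancel : ∀ g h → g · (inv g · h) ≡ h
·-inverseʳ-cancel g h = begin
  g · (inv g · h)  ≡⟨ ·-assoc g (inv g) h ⟨
  (g · inv g) · h  ≡⟨ cong (_· h) (·-inverseʳ g) ⟩
  e · h            ≡⟨ ·-identityˡ h ⟩
  h                ∎
  where open ≡-Reasoning

S-unique : Unique S
S-unique = toWitness {a? = unique? S} _

S-nonidentity : All (λ s → s ≢ e) S
S-nonidentity = toWitness {a? = all? (λ s → ¬? (s ≟G e)) S} _

filter-Adj-↭ : ∀ g {L} → Unique L → (∀ h → h ∈ L) → filter (Adj? g) L ↭ map (g ·_) S
filter-Adj-↭ g {L} L-unique ∈L = ∼bag⇒↭ (unique∧set⇒bag
  (filter⁺ (Adj? g) {xs = L} L-unique)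
  (unique-map⁺ (·-cancelˡ g) S-unique)
  (mk⇔ (λ h∈ → map⁺ (proj₂ (∈-filter⁻ (Adj? g) {xs = L} h∈)))
       (λ h∈ → ∈-filter⁺ (Adj? g) {xs = L} (∈L _) (map⁻ h∈))))

regular : Regular (length S)
regular g = trans (↭-length (filter-Adj-↭ g allG-unique ∈-allG)) (length-map (g ·_) S)

Adj-translate : ∀ g {h f} → Adj h f → Adj (g · h) (g · f)
Adj-translate g {h} = Any.map λ {s} f≡hs → trans (cong (g ·_) f≡hs) (sym (·-assoc g h s))

Walk-translate : ∀ g {h f n} → Walk h f n → Walk (g · h) (g · f) n
Walk-translate g here         = here
Walk-translate g (step adj w) = step (Adj-translate g adj) (Walk-translate g w)

DistLE-from-e : ∀ {k} → (∀ g → DistLE e g k) → ∀ g h → DistLE g h k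
DistLE-from-e from-e g h with from-e (inv g · h)
... | n , n≤k , w =
  n , n≤k , subst₂ (λ a b → Walk a b n) (·-identityʳ g) (·-inverseʳ-cancel g h) (Walk-translate g w)

Walk-snoc : ∀ {g h f n} → Walk g h n → Adj h f → Walk g f (suc n)
Walk-snoc here       adj = step adj here
Walk-snoc (step a w) adj = step a (Walk-snoc w adj)

Lipschitz : (G → ℕ) → Set
Lipschitz d = ∀ g h → Adj g h → d h ≤ suc (d g)

Lipschitz-along-Walk : ∀ d → Lipschitz d → ∀ {g h n} → Walk g h n → d h ≤ d g + n
Lipschitz-along-Walk d lip {g} here = ≤-reflexive (sym (+-identityʳ (d g)))
Lipschitz-along-Walk d lip {g} {f} {suc n} (step {y = h} adj w) = begin
  d f             ≤⟨ Lipschitz-along-Walk d lip w ⟩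
  d h + n         ≤⟨ +-monoˡ-≤ n (lip g h adj) ⟩
  suc (d g) + n   ≡⟨ +-suc (d g) n ⟨
  d g + suc n     ∎
  where open ≤-Reasoning

Descending : (G → ℕ) → Set
Descending d = ∀ h → h ≡ e ⊎ ∃[ g ] (Adj g h × suc (d g) ≡ d h)

Descending⇒Walk : ∀ {d} → d e ≡ 0 → Descending d → ∀ h → Walk e h (d h)
Descending⇒Walk {d} de≡0 descending h = walk (d h) h refl
  where
  walk : ∀ n h → d h ≡ n → Walk e h n
  walk n h dh≡n with descending h
  walk zero    _ _      | inj₁ refl                = here
  walk (suc n) _ de≡1+n | inj₁ refl                = contradiction (trans (sym de≡0) de≡1+n) 0≢1+n
  walk zero    _ dh≡0   | inj₂ (_ , _ , 1+dg≡dh)   = contradiction (trans 1+dg≡dh dh≡0) 1+n≢0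
  walk (suc n) _ dh≡1+n | inj₂ (g , g~h , 1+dg≡dh) =
    Walk-snoc (walk n g (suc-injective (trans 1+dg≡dh dh≡1+n))) g~h

-- Row x, column y is the distance from e to [x,y], found by breadth-first search outside
-- Agda; nothing depends on it beyond the exhaustive checks below.
distance-table : Vec (Vec ℕ 77) 15
distance-table =
    (0 ∷ 6 ∷ 7 ∷ 7 ∷ 6 ∷ 7 ∷ 4 ∷ 5 ∷ 5 ∷ 6 ∷ 6 ∷ 5 ∷ 5 ∷ 6 ∷ 7 ∷ 4 ∷ 4 ∷ 6 ∷ 7 ∷ 6 ∷ 7 ∷ 6 ∷ 7 ∷ 6 ∷ 6 ∷ 6 ∷ 5 ∷ 7 ∷ 3 ∷ 5 ∷ 5 ∷ 7 ∷ 5 ∷ 7 ∷ 5 ∷ 5 ∷ 6 ∷ 4 ∷ 7 ∷ 7 ∷ 4 ∷ 6 ∷ 5 ∷ 5 ∷ 7 ∷ 5 ∷ 7 ∷ 5 ∷ 5 ∷ 3 ∷ 7 ∷ 5 ∷ 6 ∷ 6 ∷ 6 ∷ 7 ∷ 6 ∷ 7 ∷ 6 ∷ 7 ∷ 6 ∷ 4 ∷ 4 ∷ 7 ∷ 6 ∷ 5 ∷ 5 ∷ 6 ∷ 6 ∷ 5 ∷ 5 ∷ 4 ∷ 7 ∷ 6 ∷ 7 ∷ 7 ∷ 6 ∷ [])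
  ∷ (6 ∷ 5 ∷ 6 ∷ 6 ∷ 6 ∷ 6 ∷ 4 ∷ 6 ∷ 6 ∷ 5 ∷ 7 ∷ 5 ∷ 7 ∷ 6 ∷ 6 ∷ 6 ∷ 6 ∷ 3 ∷ 3 ∷ 7 ∷ 6 ∷ 5 ∷ 7 ∷ 6 ∷ 5 ∷ 5 ∷ 6 ∷ 7 ∷ 7 ∷ 6 ∷ 6 ∷ 5 ∷ 5 ∷ 5 ∷ 3 ∷ 7 ∷ 6 ∷ 7 ∷ 5 ∷ 6 ∷ 6 ∷ 7 ∷ 5 ∷ 6 ∷ 6 ∷ 6 ∷ 6 ∷ 4 ∷ 5 ∷ 6 ∷ 6 ∷ 4 ∷ 6 ∷ 6 ∷ 5 ∷ 6 ∷ 6 ∷ 7 ∷ 5 ∷ 6 ∷ 2 ∷ 6 ∷ 6 ∷ 6 ∷ 6 ∷ 6 ∷ 2 ∷ 6 ∷ 6 ∷ 6 ∷ 6 ∷ 5 ∷ 6 ∷ 6 ∷ 7 ∷ 6 ∷ 4 ∷ [])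
  ∷ (6 ∷ 7 ∷ 6 ∷ 6 ∷ 6 ∷ 7 ∷ 7 ∷ 6 ∷ 6 ∷ 6 ∷ 6 ∷ 6 ∷ 4 ∷ 6 ∷ 6 ∷ 6 ∷ 4 ∷ 6 ∷ 6 ∷ 7 ∷ 6 ∷ 7 ∷ 4 ∷ 6 ∷ 6 ∷ 6 ∷ 5 ∷ 5 ∷ 6 ∷ 6 ∷ 6 ∷ 7 ∷ 6 ∷ 6 ∷ 6 ∷ 6 ∷ 7 ∷ 6 ∷ 7 ∷ 4 ∷ 6 ∷ 7 ∷ 3 ∷ 5 ∷ 7 ∷ 7 ∷ 7 ∷ 6 ∷ 5 ∷ 4 ∷ 5 ∷ 3 ∷ 5 ∷ 4 ∷ 6 ∷ 5 ∷ 4 ∷ 5 ∷ 5 ∷ 6 ∷ 6 ∷ 5 ∷ 6 ∷ 7 ∷ 6 ∷ 6 ∷ 7 ∷ 3 ∷ 6 ∷ 4 ∷ 6 ∷ 7 ∷ 4 ∷ 6 ∷ 6 ∷ 4 ∷ 6 ∷ [])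
  ∷ (6 ∷ 5 ∷ 5 ∷ 5 ∷ 7 ∷ 7 ∷ 6 ∷ 6 ∷ 4 ∷ 7 ∷ 5 ∷ 5 ∷ 6 ∷ 7 ∷ 7 ∷ 6 ∷ 5 ∷ 6 ∷ 6 ∷ 7 ∷ 3 ∷ 7 ∷ 6 ∷ 6 ∷ 5 ∷ 6 ∷ 5 ∷ 6 ∷ 6 ∷ 5 ∷ 6 ∷ 2 ∷ 4 ∷ 5 ∷ 6 ∷ 7 ∷ 5 ∷ 6 ∷ 5 ∷ 5 ∷ 6 ∷ 6 ∷ 7 ∷ 5 ∷ 6 ∷ 5 ∷ 4 ∷ 4 ∷ 4 ∷ 7 ∷ 6 ∷ 6 ∷ 5 ∷ 6 ∷ 6 ∷ 6 ∷ 6 ∷ 7 ∷ 6 ∷ 5 ∷ 7 ∷ 5 ∷ 6 ∷ 7 ∷ 7 ∷ 7 ∷ 7 ∷ 6 ∷ 6 ∷ 5 ∷ 7 ∷ 4 ∷ 6 ∷ 7 ∷ 5 ∷ 5 ∷ 6 ∷ [])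
  ∷ (6 ∷ 7 ∷ 7 ∷ 7 ∷ 5 ∷ 6 ∷ 6 ∷ 7 ∷ 5 ∷ 5 ∷ 5 ∷ 6 ∷ 7 ∷ 6 ∷ 5 ∷ 6 ∷ 7 ∷ 6 ∷ 5 ∷ 6 ∷ 4 ∷ 2 ∷ 6 ∷ 6 ∷ 5 ∷ 6 ∷ 6 ∷ 6 ∷ 3 ∷ 5 ∷ 4 ∷ 6 ∷ 6 ∷ 5 ∷ 6 ∷ 6 ∷ 2 ∷ 6 ∷ 6 ∷ 7 ∷ 4 ∷ 5 ∷ 6 ∷ 5 ∷ 6 ∷ 6 ∷ 6 ∷ 7 ∷ 5 ∷ 5 ∷ 5 ∷ 5 ∷ 5 ∷ 6 ∷ 7 ∷ 7 ∷ 6 ∷ 6 ∷ 5 ∷ 7 ∷ 6 ∷ 4 ∷ 7 ∷ 5 ∷ 3 ∷ 5 ∷ 7 ∷ 7 ∷ 3 ∷ 5 ∷ 5 ∷ 6 ∷ 7 ∷ 6 ∷ 6 ∷ 6 ∷ 6 ∷ [])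
  ∷ (6 ∷ 7 ∷ 6 ∷ 7 ∷ 7 ∷ 7 ∷ 6 ∷ 5 ∷ 3 ∷ 5 ∷ 6 ∷ 6 ∷ 6 ∷ 6 ∷ 5 ∷ 7 ∷ 6 ∷ 6 ∷ 5 ∷ 6 ∷ 5 ∷ 6 ∷ 7 ∷ 7 ∷ 1 ∷ 5 ∷ 6 ∷ 6 ∷ 5 ∷ 6 ∷ 5 ∷ 6 ∷ 6 ∷ 6 ∷ 7 ∷ 6 ∷ 6 ∷ 6 ∷ 7 ∷ 5 ∷ 5 ∷ 5 ∷ 6 ∷ 6 ∷ 7 ∷ 5 ∷ 6 ∷ 7 ∷ 7 ∷ 7 ∷ 4 ∷ 7 ∷ 4 ∷ 6 ∷ 4 ∷ 7 ∷ 4 ∷ 6 ∷ 4 ∷ 6 ∷ 7 ∷ 3 ∷ 7 ∷ 6 ∷ 5 ∷ 5 ∷ 6 ∷ 4 ∷ 6 ∷ 4 ∷ 7 ∷ 6 ∷ 6 ∷ 2 ∷ 7 ∷ 6 ∷ 5 ∷ [])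
  ∷ (6 ∷ 5 ∷ 1 ∷ 7 ∷ 6 ∷ 7 ∷ 7 ∷ 6 ∷ 3 ∷ 6 ∷ 6 ∷ 5 ∷ 7 ∷ 4 ∷ 6 ∷ 5 ∷ 6 ∷ 5 ∷ 3 ∷ 7 ∷ 6 ∷ 5 ∷ 7 ∷ 6 ∷ 7 ∷ 5 ∷ 6 ∷ 5 ∷ 6 ∷ 6 ∷ 4 ∷ 6 ∷ 6 ∷ 7 ∷ 6 ∷ 6 ∷ 4 ∷ 4 ∷ 7 ∷ 5 ∷ 6 ∷ 7 ∷ 5 ∷ 6 ∷ 4 ∷ 6 ∷ 6 ∷ 6 ∷ 6 ∷ 6 ∷ 4 ∷ 4 ∷ 6 ∷ 4 ∷ 7 ∷ 5 ∷ 7 ∷ 6 ∷ 7 ∷ 6 ∷ 6 ∷ 6 ∷ 7 ∷ 5 ∷ 5 ∷ 6 ∷ 5 ∷ 4 ∷ 6 ∷ 7 ∷ 5 ∷ 6 ∷ 6 ∷ 5 ∷ 6 ∷ 7 ∷ 6 ∷ [])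
  ∷ (7 ∷ 7 ∷ 6 ∷ 5 ∷ 6 ∷ 6 ∷ 6 ∷ 5 ∷ 6 ∷ 6 ∷ 7 ∷ 5 ∷ 6 ∷ 6 ∷ 5 ∷ 5 ∷ 6 ∷ 6 ∷ 7 ∷ 6 ∷ 6 ∷ 5 ∷ 7 ∷ 5 ∷ 7 ∷ 4 ∷ 4 ∷ 6 ∷ 7 ∷ 6 ∷ 7 ∷ 6 ∷ 6 ∷ 5 ∷ 7 ∷ 6 ∷ 7 ∷ 7 ∷ 5 ∷ 6 ∷ 6 ∷ 4 ∷ 4 ∷ 6 ∷ 7 ∷ 6 ∷ 5 ∷ 6 ∷ 5 ∷ 6 ∷ 4 ∷ 6 ∷ 5 ∷ 7 ∷ 6 ∷ 3 ∷ 6 ∷ 6 ∷ 7 ∷ 5 ∷ 6 ∷ 5 ∷ 6 ∷ 5 ∷ 5 ∷ 6 ∷ 4 ∷ 6 ∷ 3 ∷ 5 ∷ 7 ∷ 5 ∷ 7 ∷ 5 ∷ 3 ∷ 7 ∷ 7 ∷ [])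
  ∷ (7 ∷ 6 ∷ 7 ∷ 6 ∷ 3 ∷ 6 ∷ 4 ∷ 4 ∷ 5 ∷ 7 ∷ 6 ∷ 5 ∷ 4 ∷ 6 ∷ 5 ∷ 7 ∷ 4 ∷ 7 ∷ 7 ∷ 5 ∷ 6 ∷ 6 ∷ 4 ∷ 6 ∷ 5 ∷ 6 ∷ 6 ∷ 3 ∷ 5 ∷ 6 ∷ 5 ∷ 6 ∷ 6 ∷ 7 ∷ 6 ∷ 6 ∷ 5 ∷ 6 ∷ 7 ∷ 6 ∷ 5 ∷ 6 ∷ 5 ∷ 5 ∷ 3 ∷ 7 ∷ 6 ∷ 6 ∷ 5 ∷ 5 ∷ 5 ∷ 6 ∷ 7 ∷ 6 ∷ 5 ∷ 5 ∷ 7 ∷ 6 ∷ 6 ∷ 6 ∷ 6 ∷ 7 ∷ 7 ∷ 7 ∷ 7 ∷ 6 ∷ 7 ∷ 5 ∷ 7 ∷ 7 ∷ 6 ∷ 5 ∷ 5 ∷ 6 ∷ 4 ∷ 6 ∷ 6 ∷ [])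
  ∷ (6 ∷ 7 ∷ 6 ∷ 6 ∷ 5 ∷ 1 ∷ 5 ∷ 6 ∷ 6 ∷ 7 ∷ 6 ∷ 5 ∷ 4 ∷ 4 ∷ 5 ∷ 7 ∷ 6 ∷ 4 ∷ 7 ∷ 6 ∷ 3 ∷ 5 ∷ 5 ∷ 6 ∷ 5 ∷ 6 ∷ 6 ∷ 6 ∷ 5 ∷ 5 ∷ 7 ∷ 6 ∷ 6 ∷ 4 ∷ 6 ∷ 6 ∷ 6 ∷ 6 ∷ 6 ∷ 6 ∷ 6 ∷ 5 ∷ 5 ∷ 6 ∷ 7 ∷ 3 ∷ 7 ∷ 6 ∷ 4 ∷ 6 ∷ 6 ∷ 7 ∷ 4 ∷ 6 ∷ 4 ∷ 7 ∷ 6 ∷ 7 ∷ 7 ∷ 5 ∷ 7 ∷ 6 ∷ 6 ∷ 7 ∷ 7 ∷ 6 ∷ 5 ∷ 5 ∷ 7 ∷ 6 ∷ 6 ∷ 4 ∷ 7 ∷ 6 ∷ 6 ∷ 4 ∷ 5 ∷ [])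
  ∷ (6 ∷ 4 ∷ 6 ∷ 3 ∷ 7 ∷ 5 ∷ 6 ∷ 7 ∷ 7 ∷ 1 ∷ 7 ∷ 7 ∷ 6 ∷ 5 ∷ 6 ∷ 5 ∷ 6 ∷ 6 ∷ 7 ∷ 5 ∷ 6 ∷ 4 ∷ 6 ∷ 6 ∷ 5 ∷ 5 ∷ 5 ∷ 6 ∷ 7 ∷ 6 ∷ 7 ∷ 6 ∷ 7 ∷ 6 ∷ 5 ∷ 6 ∷ 6 ∷ 2 ∷ 4 ∷ 6 ∷ 7 ∷ 4 ∷ 6 ∷ 6 ∷ 6 ∷ 6 ∷ 5 ∷ 7 ∷ 7 ∷ 5 ∷ 7 ∷ 6 ∷ 6 ∷ 6 ∷ 4 ∷ 7 ∷ 6 ∷ 6 ∷ 4 ∷ 6 ∷ 6 ∷ 7 ∷ 6 ∷ 5 ∷ 6 ∷ 5 ∷ 7 ∷ 5 ∷ 6 ∷ 5 ∷ 5 ∷ 3 ∷ 7 ∷ 7 ∷ 4 ∷ 6 ∷ 7 ∷ [])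
  ∷ (6 ∷ 5 ∷ 6 ∷ 7 ∷ 7 ∷ 5 ∷ 5 ∷ 6 ∷ 6 ∷ 6 ∷ 5 ∷ 5 ∷ 5 ∷ 6 ∷ 6 ∷ 5 ∷ 7 ∷ 6 ∷ 7 ∷ 3 ∷ 7 ∷ 5 ∷ 7 ∷ 5 ∷ 7 ∷ 3 ∷ 5 ∷ 5 ∷ 5 ∷ 6 ∷ 4 ∷ 7 ∷ 7 ∷ 6 ∷ 6 ∷ 5 ∷ 5 ∷ 6 ∷ 5 ∷ 6 ∷ 7 ∷ 6 ∷ 3 ∷ 7 ∷ 7 ∷ 4 ∷ 6 ∷ 6 ∷ 6 ∷ 7 ∷ 7 ∷ 6 ∷ 5 ∷ 4 ∷ 2 ∷ 6 ∷ 5 ∷ 6 ∷ 6 ∷ 5 ∷ 4 ∷ 6 ∷ 7 ∷ 6 ∷ 6 ∷ 5 ∷ 6 ∷ 6 ∷ 6 ∷ 6 ∷ 2 ∷ 6 ∷ 5 ∷ 6 ∷ 6 ∷ 5 ∷ 6 ∷ [])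
  ∷ (6 ∷ 7 ∷ 5 ∷ 5 ∷ 5 ∷ 7 ∷ 5 ∷ 7 ∷ 6 ∷ 6 ∷ 6 ∷ 7 ∷ 5 ∷ 6 ∷ 6 ∷ 6 ∷ 6 ∷ 6 ∷ 5 ∷ 5 ∷ 5 ∷ 7 ∷ 6 ∷ 6 ∷ 7 ∷ 6 ∷ 6 ∷ 5 ∷ 6 ∷ 5 ∷ 7 ∷ 6 ∷ 2 ∷ 6 ∷ 7 ∷ 7 ∷ 6 ∷ 7 ∷ 4 ∷ 5 ∷ 6 ∷ 4 ∷ 6 ∷ 3 ∷ 5 ∷ 4 ∷ 5 ∷ 6 ∷ 4 ∷ 7 ∷ 6 ∷ 4 ∷ 7 ∷ 7 ∷ 7 ∷ 6 ∷ 7 ∷ 4 ∷ 5 ∷ 5 ∷ 5 ∷ 6 ∷ 5 ∷ 7 ∷ 6 ∷ 5 ∷ 5 ∷ 5 ∷ 6 ∷ 6 ∷ 7 ∷ 6 ∷ 6 ∷ 6 ∷ 5 ∷ 6 ∷ 7 ∷ [])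
  ∷ (6 ∷ 5 ∷ 7 ∷ 6 ∷ 6 ∷ 6 ∷ 5 ∷ 3 ∷ 5 ∷ 6 ∷ 7 ∷ 5 ∷ 4 ∷ 6 ∷ 6 ∷ 6 ∷ 5 ∷ 7 ∷ 6 ∷ 6 ∷ 6 ∷ 4 ∷ 6 ∷ 6 ∷ 7 ∷ 6 ∷ 7 ∷ 6 ∷ 6 ∷ 4 ∷ 6 ∷ 5 ∷ 5 ∷ 6 ∷ 4 ∷ 4 ∷ 6 ∷ 6 ∷ 6 ∷ 4 ∷ 4 ∷ 6 ∷ 7 ∷ 7 ∷ 7 ∷ 5 ∷ 6 ∷ 6 ∷ 6 ∷ 7 ∷ 6 ∷ 7 ∷ 6 ∷ 6 ∷ 6 ∷ 7 ∷ 6 ∷ 4 ∷ 6 ∷ 5 ∷ 7 ∷ 6 ∷ 6 ∷ 6 ∷ 6 ∷ 7 ∷ 4 ∷ 7 ∷ 3 ∷ 3 ∷ 6 ∷ 7 ∷ 6 ∷ 6 ∷ 5 ∷ 6 ∷ 4 ∷ [])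
  ∷ (6 ∷ 6 ∷ 6 ∷ 6 ∷ 6 ∷ 7 ∷ 6 ∷ 6 ∷ 6 ∷ 7 ∷ 7 ∷ 5 ∷ 6 ∷ 5 ∷ 5 ∷ 3 ∷ 6 ∷ 5 ∷ 6 ∷ 5 ∷ 7 ∷ 6 ∷ 2 ∷ 6 ∷ 5 ∷ 5 ∷ 6 ∷ 6 ∷ 5 ∷ 5 ∷ 3 ∷ 6 ∷ 6 ∷ 7 ∷ 3 ∷ 6 ∷ 7 ∷ 4 ∷ 6 ∷ 6 ∷ 5 ∷ 6 ∷ 6 ∷ 6 ∷ 6 ∷ 4 ∷ 4 ∷ 6 ∷ 6 ∷ 7 ∷ 5 ∷ 7 ∷ 6 ∷ 7 ∷ 6 ∷ 5 ∷ 6 ∷ 6 ∷ 4 ∷ 6 ∷ 6 ∷ 6 ∷ 2 ∷ 6 ∷ 6 ∷ 5 ∷ 6 ∷ 6 ∷ 6 ∷ 5 ∷ 7 ∷ 5 ∷ 6 ∷ 6 ∷ 7 ∷ 6 ∷ 6 ∷ [])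
  ∷ []

dist : G → ℕ
dist (x , y) = lookup (lookup distance-table x) y

dist-Lipschitz : Lipschitz dist
dist-Lipschitz g h =
  All.lookupWith (λ le h≡gs → subst (λ f → dist f ≤ suc (dist g)) (sym h≡gs) le) (steps-checked g)
  where
  steps-checked : ∀ g → All (λ s → dist (g · s) ≤ suc (dist g)) S
  steps-checked = by-exhaustion (λ g → all? (λ s → dist (g · s) ≤? suc (dist g)) S) _

dist-Descending : Descending dist
dist-Descending h = map₂ (λ desc → let s , down = Any.satisfied desc in h · s , down) (descent-checked h)
  where
  -- S is inverse-closed, so every neighbour of h has the form h · s.
  descent-checked : ∀ h → h ≡ e ⊎ Any (λ s → Adj (h · s) h × suc (dist (h · s)) ≡ dist h) S
  descent-checked = by-exhaustion
    (λ h → (h ≟G e) ⊎-dec any? (λ s → Adj? (h · s) h ×-dec (suc (dist (h · s)) ≟ dist h)) S) _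

dist≤7 : ∀ g → dist g ≤ 7
dist≤7 = by-exhaustion (λ g → dist g ≤? 7) _

mainTheorem1 : (length S ≡ 4 × Unique S × All (λ s → s ≢ e) S)
    × (length allG ≡ 1155 × Connected × Regular 4 × HasDiameter 7)
mainTheorem1 = (refl , S-unique , S-nonidentity) , (refl , connected , regular , diameter)
  where
  within-7 : ∀ g h → DistLE g h 7
  within-7 = DistLE-from-e λ h → dist h , dist≤7 h , Descending⇒Walk refl dist-Descending h

  connected : Connected
  connected g h = let n , _ , w = within-7 g h in n , w

  far : G
  far = mod 14 12 , mod 76 21

  diameter : HasDiameter 7
  diameter = within-7 , e , far , within-7 e far , λ n w → Lipschitz-along-Walk dist dist-Lipschitz w
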